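{- Let $\mathbb{F}_q$ be a finite field, $k\ge 1$, and let $M$ be a trail of level $k$ (so $\nu_M$ assigns exactly $x_1\mapsto\alpha_1,\dots,x_{k-1}\mapsto\alpha_{k-1}$, and we write $\boldsymbol{\alpha}_M=(\alpha_1,\dots,\alpha_{k-1})\in\mathbb{F}_q^{k-1}$). Let $f$ be a polynomial constraint with polynomial in $\mathbb{F}_q[x_1,\dots,x_k]$ such that $f\notin\mathrm{constraints}(M)$ and $\lnot f$ is not compatible with $M$. Let $$A=\{f'\in\mathrm{constraints}(M)\mid \mathrm{level}(f')=k\}\cup\{\lnot f\},$$ let $A_{=}=\{p\mid (p=0)\in A\}$ and $A_{\neq}=\{p\mid (p\neq 0)\in A\}$. Let $\Delta=\{(P_1,Q_1),\dots,(P_r,Q_r)\}$ be a weak projecting zero decomposition of $(A_{=},A_{\neq})$ for $\boldsymbol{\alpha}_M$. For each $1\le \ell\le r$ choose a polynomial $u_\ell\in\mathbb{F}_q[x_1,\dots,x_{k-1}]$ with either $u_\ell\in P_\ell$ and $u_\ell(\boldsymbol{\alpha}_M)\neq 0$, in which case set $c_\ell$ to be the constraint $u_\ell=0$, or $u_\ell\in Q_\ell$ and $u_\ell(\boldsymbol{\alpha}_M)=0$, in which case set $c_\ell$ to be the constraint $u_\ell\neq 0$. Let $C=\{c_1,\dots,c_r\}$. Then the clause $E=\{\lnot a\mid a\in A\}\cup C$ is an explanation clause for $f$ in $M$.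
   Context: Variables $x_1<x_2<\dots<x_n$; $X_k=\{x_1,\dots,x_k\}$. A polynomial constraint is $p=0$ or $p\neq 0$ with $p\in\mathbb{F}_q[x_1,\dots,x_n]$; its negation swaps $=$ and $\neq$. The level of a constraint is the largest $i$ such that $x_i$ occurs in its polynomial. An assignment $\nu$ satisfies $p\vartriangleright 0$ if $\nu(p)\vartriangleright 0$; a clause (set of constraints, read as a disjunction) is satisfied if some member is. A trail $M$ is a sequence whose elements are polynomial constraints (literals) or variable assignments $x_i\mapsto\alpha\in\mathbb{F}_q$; $\mathrm{constraints}(M)$ is the set of constraints on $M$; $M$ has level $k$ if its variable assignments are exactly $x_1\mapsto\alpha_1,\dots,x_{k-1}\mapsto\alpha_{k-1}$, giving the partial assignment $\nu_M$; all constraints on $M$ have polynomials in $\mathbb{F}_q[X_k]$. For a constraint $g$ with polynomial in $\mathbb{F}_q[X_k]$: $\mathrm{value}(g,M)=\nu_M(g)$ if $x_k$ does not occur in $g$; $=\mathrm{true}$ if $g\in\mathrm{constraints}(M)$; $=\mathrm{false}$ if $\lnot g\in\mathrm{constraints}(M)$; undefined otherwise. $\mathrm{feasible}(g,M)$ is the set of $\beta\in\mathbb{F}_q$ such that the extension of $\nu_M$ by $x_k\mapsto\beta$ satisfies $g$ and all constraints of $M$; $g$ is compatible with $M$ if this set is nonempty. A clause $E$ is a valid lemma if no total assignment $\nu:\{x_1,\dots,x_n\}\to\mathbb{F}_q$ makes $E$ false; $E$ justifies $f$ in $M$ if $f\in E$ and $\mathrm{value}(f',M)=\mathrm{false}$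 for every $f'\in E$ with $f'\neq f$; $E$ is an explanation clause for $f$ in $M$ if it is a valid lemma and justifies $f$ in $M$. For finite $P,Q\subset\mathbb{F}_q[X_k]$, $\mathrm{zero}_q(P/Q)=\{\boldsymbol{\xi}\in\mathbb{F}_q^k\mid p(\boldsymbol{\xi})=0\ \forall p\in P,\ q(\boldsymbol{\xi})\neq 0\ \forall q\in Q\}$ and $\mathrm{proj}_k\mathrm{zero}_q(P/Q)=\{\boldsymbol{\alpha}\in\mathbb{F}_q^{k-1}\mid\exists\beta\in\mathbb{F}_q:(\boldsymbol{\alpha},\beta)\in\mathrm{zero}_q(P/Q)\}$. Given $\boldsymbol{\alpha}\in\mathbb{F}_q^{k-1}$ such that no $\beta\in\mathbb{F}_q$ has $(\boldsymbol{\alpha},\beta)\in\mathrm{zero}_q(P/Q)$, a weak projecting zero decomposition of $(P,Q)$ for $\boldsymbol{\alpha}$ is a finite set $\Delta$ of pairs $(P',Q')$ of finite subsets of $\mathbb{F}_q[X_{k-1}]$ such that $\mathrm{proj}_k\mathrm{zero}_q(P/Q)\subseteq\bigcup_{(P',Q')\in\Delta}\mathrm{zero}_q(P'/Q')$ and $\boldsymbol{\alpha}\notin\mathrm{zero}_q(P'/Q')$ for all $(P',Q')\in\Delta$. -}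

module Defs where

open import Data.Nat using (ℕ; zero; suc; _≤_; _<_)
open import Data.Bool using (Bool; true; false)
open import Data.Fin using (Fin; toℕ)
open import Data.List using (List; []; _∷_; drop; _++_)
open import Data.List.Relation.Unary.All using (All)
open import Data.List.Relation.Unary.Any using (Any)
open import Data.List.Membership.Propositional using (_∈_)
open import Data.Vec using (Vec; []; _∷_; init; last; lookup; toList; _∷ʳ_)
open import Data.Product using (Σ; ∃; ∃-syntax; _×_; _,_; proj₁; proj₂)
open import Data.Sum using (_⊎_)
open import Data.Empty using (⊥)
open import Data.Unit using (⊤)
open import Relation.Nullary using (¬_)
open import Relation.Binary.PropositionalEquality using (_≡_; _≢_)
open import Algebra.Structures using (IsCommutativeRing)
open import Relation.Binary.Definitions using (DecidableEquality)

record FiniteField : Set₁ where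
  field
    Carrier : Set
    _+_ _*_ : Carrier → Carrier → Carrier
    -_      : Carrier → Carrier
    0# 1#   : Carrier
    isCommutativeRing : IsCommutativeRing _≡_ _+_ _*_ -_ 0# 1#
    0≢1     : 0# ≢ 1#
    _≟_     : DecidableEquality Carrier
    inverse : ∀ x → x ≢ 0# → ∃[ y ] (x * y ≡ 1#)
    elements : List Carrier
    complete : ∀ x → x ∈ elements

module FF (F : FiniteField) where
  open FiniteField F renaming (Carrier to C)

  -- Polynomials in F_q[x_1,…,x_n], dense recursive representation:
  -- RPoly 0 = F_q, and an element of RPoly (suc n) is the coefficient
  -- list [c_0, c_1, …] (lowest degree first) of  Σ_j c_j · x_{n+1}^j
  -- with c_j ∈ F_q[x_1,…,x_n].

  RPoly : ℕ → Set
  RPoly zero    = C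
  RPoly (suc n) = List (RPoly n)

  IsZeroR : ∀ {n} → RPoly n → Set
  IsZeroR {zero}  c  = c ≡ 0#
  IsZeroR {suc n} cs = All (IsZeroR {n}) cs

  LastNonZero : ∀ n → List (RPoly n) → Set
  LastNonZero n []           = ⊤
  LastNonZero n (c ∷ [])     = ¬ IsZeroR {n} c
  LastNonZero n (c ∷ d ∷ ds) = LastNonZero n (d ∷ ds)

  -- canonical (normalised) representation: every polynomial has exactly one
  Normal : ∀ {n} → RPoly n → Set
  Normal {zero}  c  = ⊤
  Normal {suc n} cs = All (Normal {n}) cs × LastNonZero n cs

  record Poly (n : ℕ) : Set where
    constructor poly
    field
      raw     : RPoly n
      .normal : Normal {n} raw
  open Poly public

  -- x_i (1-based index i) occurs in p: some monomial with nonzero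
  -- coefficient has positive degree in x_i
  OccursR : ∀ {n} → ℕ → RPoly n → Set
  OccursR {zero}  i c  = ⊥
  OccursR {suc n} i cs =
    (i ≡ suc n × Any (λ c → ¬ IsZeroR {n} c) (drop 1 cs)) ⊎ Any (OccursR {n} i) cs

  Occurs : ∀ {n} → ℕ → Poly n → Set
  Occurs {n} i p = OccursR {n} i (raw p)

  InVars : ∀ {n} → ℕ → Poly n → Set
  InVars k p = ∀ j → Occurs j p → j ≤ k

  HasLevel : ∀ {n} → ℕ → Poly n → Set
  HasLevel k p = Occurs k p × InVars k p

  horner : List C → C → C
  horner []       x = 0#
  horner (a ∷ as) x = a + (x * horner as x)

  evalR : ∀ {n} → RPoly n → Vec C n → C
  evalR {zero}  c  []  = c
  evalR {suc n} cs v   = horner (Data.List.map (λ c → evalR {n} c (init v)) cs) (last v)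

  eval : ∀ {n} → Poly n → Vec C n → C
  eval {n} p v = evalR {n} (raw p) v

  -- partial assignments: γ ∈ F_q^j assigns x_1,…,x_j; w ∈ F_q^n extends γ
  Extends : ∀ {j n} → Vec C j → Vec C n → Set
  Extends γ w = ∃[ r ] (toList w ≡ toList γ ++ r)

  -- value of p under the partial assignment γ (meaningful when the
  -- variables of p are among x_1,…,x_j): every total extension gives c
  EvalTo : ∀ {j n} → Vec C j → Poly n → C → Set
  EvalTo γ p c = ∀ w → Extends γ w → eval p w ≡ c

  NonzeroAt : ∀ {j n} → Vec C j → Poly n → Set
  NonzeroAt γ p = ∀ w → Extends γ w → eval p w ≢ 0#

  data Rel : Set where
    ≐0 ≠0 : Rel

  flipRel : Rel → Rel
  flipRel ≐0 = ≠0
  flipRel ≠0 = ≐0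

  Constraint : ℕ → Set
  Constraint n = Poly n × Rel

  cpoly : ∀ {n} → Constraint n → Poly n
  cpoly = proj₁

  neg : ∀ {n} → Constraint n → Constraint n
  neg (p , r) = p , flipRel r

  Sat : ∀ {n} → Vec C n → Constraint n → Set
  Sat ν (p , ≐0) = eval p ν ≡ 0#
  Sat ν (p , ≠0) = eval p ν ≢ 0#

  PSat : ∀ {j n} → Vec C j → Constraint n → Set
  PSat γ g = ∀ w → Extends γ w → Sat w g

  PFalse : ∀ {j n} → Vec C j → Constraint n → Set
  PFalse γ g = ∀ w → Extends γ w → ¬ Sat w g

  -- clauses are sets (predicates) of constraints, read disjunctively
  Clause : ℕ → Set₁
  Clause n = Constraint n → Set

  data TrailElem (n : ℕ) : Set where
    lit    : Constraint n → TrailElem n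
    assign : ℕ → C → TrailElem n        -- x_i ↦ β  (1-based i)

  Trail : ℕ → Set
  Trail n = List (TrailElem n)

  InConstraints : ∀ {n} → Constraint n → Trail n → Set
  InConstraints g M = lit g ∈ M

  -- M has level k = suc m with ν_M = (x_1 ↦ α_1, …, x_m ↦ α_m)
  IsLevel : ∀ {n} → Trail n → (m : ℕ) → Vec C m → Set
  IsLevel M m α =
    (∀ i β → assign i β ∈ M → ∃[ j ] (i ≡ suc (toℕ j) × β ≡ lookup α j))
    × (∀ (j : Fin m) → assign (suc (toℕ j)) (lookup α j) ∈ M)
    × (∀ g → InConstraints g M → InVars (suc m) (cpoly g))

  data Value {n} (M : Trail n) (m : ℕ) (α : Vec C m) (g : Constraint n)
       : Bool → Set where
    evalT : ¬ Occurs (suc m) (cpoly g) → PSat α g   → Value M m α g true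
    evalF : ¬ Occurs (suc m) (cpoly g) → PFalse α g → Value M m α g false
    memT  : Occurs (suc m) (cpoly g) → InConstraints g M       → Value M m α g true
    memF  : Occurs (suc m) (cpoly g) → InConstraints (neg g) M → Value M m α g false

  Compatible : ∀ {n} → Trail n → (m : ℕ) → Vec C m → Constraint n → Set
  Compatible M m α g =
    ∃[ β ] (PSat (α ∷ʳ β) g × (∀ g' → InConstraints g' M → PSat (α ∷ʳ β) g'))

  ValidLemma : ∀ {n} → Clause n → Set
  ValidLemma E = ∀ (ν : Vec C _) → ¬ (∀ e → E e → ¬ Sat ν e)

  Justifies : ∀ {n} → Trail n → (m : ℕ) → Vec C m → Clause n → Constraint n → Set
  Justifies M m α E f = E f × (∀ f' → E f' → f' ≢ f → Value M m α f' false)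

  ExplanationClause : ∀ {n} → Trail n → (m : ℕ) → Vec C m → Clause n → Constraint n → Set
  ExplanationClause M m α E f = ValidLemma E × Justifies M m α E f

  -- zero sets and weak projecting zero decompositions
  -- (P, Q given as sets = predicates on polynomials)

  ZeroSet : ∀ {j n} → (Poly n → Set) → (Poly n → Set) → Vec C j → Set
  ZeroSet P Q ξ = (∀ p → P p → EvalTo ξ p 0#) × (∀ q → Q q → NonzeroAt ξ q)

  InProj : ∀ {m n} → (Poly n → Set) → (Poly n → Set) → Vec C m → Set
  InProj P Q ξ = ∃[ β ] ZeroSet P Q (ξ ∷ʳ β)

  PairZero : ∀ {j n} → List (Poly n) × List (Poly n) → Vec C j → Set
  PairZero (P' , Q') ξ = ZeroSet (_∈ P') (_∈ Q') ξ

  -- Δ is a weak projecting zero decomposition of (P, Q) for α ∈ F_q^m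
  -- (here k = suc m)
  IsWPZD : ∀ {n} (m : ℕ) → Vec C m → (Poly n → Set) → (Poly n → Set)
           → List (List (Poly n) × List (Poly n)) → Set
  IsWPZD m α P Q Δ =
    (¬ InProj P Q α)
    × All (λ PQ → (∀ p → p ∈ proj₁ PQ → InVars m p)
                 × (∀ q → q ∈ proj₂ PQ → InVars m q)) Δ
    × (∀ (ξ : Vec C m) → InProj P Q ξ → Any (λ PQ → PairZero PQ ξ) Δ)
    × All (λ PQ → ¬ PairZero PQ α) Δ

  data Choice {n} (m : ℕ) (α : Vec C m) : List (Poly n) × List (Poly n) → Set where
    inP : ∀ {P' Q'} (u : Poly n) → InVars m u → u ∈ P' → NonzeroAt α u
          → Choice m α (P' , Q')
    inQ : ∀ {P' Q'} (u : Poly n) → InVars m u → u ∈ Q' → EvalTo α u 0#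
          → Choice m α (P' , Q')

  choiceConstraint : ∀ {n m α PQ} → Choice {n} m α PQ → Constraint n
  choiceConstraint (inP u _ _ _) = u , ≐0
  choiceConstraint (inQ u _ _ _) = u , ≠0

  SetA : ∀ {n} → Trail n → ℕ → Constraint n → Clause n
  SetA M k f a = (InConstraints a M × HasLevel k (cpoly a)) ⊎ a ≡ neg f

  A⁼ : ∀ {n} → Clause n → Poly n → Set
  A⁼ A p = A (p , ≐0)

  A≠ : ∀ {n} → Clause n → Poly n → Set
  A≠ A p = A (p , ≠0)

{-# OPTIONS --safe #-}
-- A total assignment ν falsifying E satisfies every constraint of A. As all of A lives in
-- F_q[X_k] and evaluation only sees the prefix (ν_1,…,ν_k), that prefix is a point of
-- zero(A₌/A≠), so (ν_1,…,ν_{k-1}) lies in the projection and hence in some zero(P_ℓ/Q_ℓ),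
-- where c_ℓ holds: a contradiction. For justification, the negation of a trail literal
-- of level k is false since the literal is on M, and each c_ℓ, having level < k, is false
-- under α_M by the choice of u_ℓ.
module Submission where

open import Defs
open import Data.Nat using (ℕ; zero; suc; _<_; _≤_; s≤s; _≤?_)
open import Data.Nat.Properties using (≤-refl; ≤-trans; ≤-reflexive; ≰⇒>)
open import Data.Fin using (Fin)
open import Data.List using (List; length; lookup; []; _∷_; _++_; take; [_])
open import Data.List.Properties using (take-all; ++-assoc)
open import Data.List.Relation.Unary.All as All using (All; []; _∷_)
open import Data.List.Relation.Unary.All.Properties using (¬Any⇒All¬; map⁺)
open import Data.List.Relation.Unary.Any using (Any; here; index)
open import Data.List.Relation.Unary.Any.Properties using (lookup-index)
open import Data.Vec using (Vec; []; _∷_; toList; _∷ʳ_; init; last; initLast)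
open import Data.Vec.Properties using (toList-∷ʳ; toList-injective; cast-is-id; length-toList)
open import Data.Product using (∃-syntax; _×_; _,_; proj₂)
open import Data.Sum using (_⊎_; inj₁; inj₂)
open import Data.Bool using (false)
open import Data.Empty using (⊥-elim)
open import Function using (_∘_)
open import Relation.Nullary using (¬_; yes; no)
open import Relation.Nullary.Decidable using (decidable-stable)
open import Relation.Unary using (_∪_)
open import Relation.Binary.PropositionalEquality
  using (_≡_; _≢_; refl; sym; trans; cong; subst; module ≡-Reasoning)
open import Algebra.Structures using (IsCommutativeRing)

open ≡-Reasoning

module _ {A : Set} where

  take-++ : ∀ k (xs ys : List A) → k ≤ length xs → take k (xs ++ ys) ≡ take k xs
  take-++ zero    xs       ys _         = refl
  take-++ (suc k) (x ∷ xs) ys (s≤s k≤n) = cong (x ∷_) (take-++ k xs ys k≤n)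

  take-toList : ∀ {n} k → n ≤ k → (w : Vec A n) → take k (toList w) ≡ toList w
  take-toList k n≤k w = take-all k (toList w) (≤-trans (≤-reflexive (length-toList w)) n≤k)

  take-toList-++ : ∀ {k} (γ : Vec A k) r → take k (toList γ ++ r) ≡ toList γ
  take-toList-++ {k} γ r = begin
    take k (toList γ ++ r) ≡⟨ take-++ k (toList γ) r (≤-reflexive (sym (length-toList γ))) ⟩
    take k (toList γ)      ≡⟨ take-toList k ≤-refl γ ⟩
    toList γ               ∎

  take-toList-init : ∀ {n} k → k ≤ n → (w : Vec A (suc n)) →
                     take k (toList (init w)) ≡ take k (toList w)
  take-toList-init k k≤n w = sym (begin
    take k (toList w)                         ≡⟨ cong (take k ∘ toList) (proj₂ (proj₂ (initLast w))) ⟩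
    take k (toList (init w ∷ʳ last w))        ≡⟨ cong (take k) (toList-∷ʳ (last w) (init w)) ⟩
    take k (toList (init w) ++ [ last w ])    ≡⟨ take-++ k _ _ (≤-trans k≤n (≤-reflexive (sym (length-toList (init w))))) ⟩
    take k (toList (init w))                  ∎)

  toList-∷ʳ-++ : ∀ {m} (ξ : Vec A m) β r → toList (ξ ∷ʳ β) ++ r ≡ toList ξ ++ β ∷ r
  toList-∷ʳ-++ ξ β r = trans (cong (_++ r) (toList-∷ʳ β ξ)) (++-assoc (toList ξ) [ β ] r)

  toList-split : ∀ {n} m → m < n → (ν : Vec A n) →
                 ∃[ ξ ] ∃[ β ] ∃[ r ] (toList ν ≡ toList {n = m} ξ ++ β ∷ r)
  toList-split zero    (s≤s _)   (x ∷ ν) = [] , x , toList ν , refl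
  toList-split (suc m) (s≤s m<n) (x ∷ ν) with toList-split m m<n ν
  ... | ξ , β , r , ν≡ = x ∷ ξ , β , r , cong (x ∷_) ν≡

module Explanation (F : FiniteField) where
  open FiniteField F renaming (Carrier to C)
  open FF F
  open IsCommutativeRing isCommutativeRing using (zeroʳ; +-identityˡ; +-identityʳ)

  horner-zeros : ∀ {as : List C} x → All (_≡ 0#) as → horner as x ≡ 0#
  horner-zeros x []              = refl
  horner-zeros {_ ∷ as} x (refl ∷ as≡0) = begin
    0# + (x * horner as x) ≡⟨ cong (λ h → 0# + (x * h)) (horner-zeros x as≡0) ⟩
    0# + (x * 0#)          ≡⟨ cong (0# +_) (zeroʳ x) ⟩
    0# + 0#                ≡⟨ +-identityˡ 0# ⟩
    0#                     ∎

  evalR-zero : ∀ {n} {p : RPoly n} (v : Vec C n) → IsZeroR {n} p → evalR {n} p v ≡ 0#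
  evalR-zero {zero}  []  p≡0 = p≡0
  evalR-zero {suc n} v   cs≡0 = horner-zeros (last v) (map⁺ (All.map (evalR-zero (init v)) cs≡0))

  evalR-vanishes : ∀ {n} {p : RPoly n} (v : Vec C n) → ¬ ¬ IsZeroR {n} p → evalR {n} p v ≡ 0#
  evalR-vanishes {n} {p} v ¬¬p≡0 =
    decidable-stable (evalR {n} p v ≟ 0#) (λ p[v]≢0 → ¬¬p≡0 (p[v]≢0 ∘ evalR-zero v))

  evalR-free-last : ∀ {n} (c : RPoly n) cs (w : Vec C (suc n)) →
                    ¬ Any (λ d → ¬ IsZeroR {n} d) cs →
                    evalR {suc n} (c ∷ cs) w ≡ evalR {n} c (init w)
  evalR-free-last {n} c cs w cs≡0 = begin
    c[w] + (x * horner (Data.List.map (λ d → evalR {n} d (init w)) cs) x)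
      ≡⟨ cong (λ h → c[w] + (x * h))
              (horner-zeros x (map⁺ (All.map (evalR-vanishes (init w)) (¬Any⇒All¬ cs cs≡0)))) ⟩
    c[w] + (x * 0#)  ≡⟨ cong (c[w] +_) (zeroʳ x) ⟩
    c[w] + 0#        ≡⟨ +-identityʳ c[w] ⟩
    c[w]             ∎
    where
    x c[w] : C
    x = last w
    c[w] = evalR {n} c (init w)

  evalR-local : ∀ {n} k (p : RPoly n) → (∀ j → OccursR {n} j p → j ≤ k) →
                (w₁ w₂ : Vec C n) → take k (toList w₁) ≡ take k (toList w₂) →
                evalR {n} p w₁ ≡ evalR {n} p w₂
  evalR-local {zero} k p _ [] [] _ = refl
  evalR-local {suc n} k p p∈Xk w₁ w₂ agree with suc n ≤? k
  ... | yes n<k = cong (evalR {suc n} p) w₁≡w₂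
    where
    w₁≡w₂ : w₁ ≡ w₂
    w₁≡w₂ = trans (sym (cast-is-id refl w₁)) (toList-injective refl w₁ w₂ (begin
      toList w₁           ≡⟨ sym (take-toList k n<k w₁) ⟩
      take k (toList w₁)  ≡⟨ agree ⟩
      take k (toList w₂)  ≡⟨ take-toList k n<k w₂ ⟩
      toList w₂           ∎))
  evalR-local {suc n} k []       p∈Xk w₁ w₂ agree | no _   = refl
  evalR-local {suc n} k (c ∷ cs) p∈Xk w₁ w₂ agree | no n≮k = begin
    evalR {suc n} (c ∷ cs) w₁  ≡⟨ evalR-free-last c cs w₁ last-free ⟩
    evalR {n} c (init w₁)      ≡⟨ evalR-local k c (λ j → p∈Xk j ∘ inj₂ ∘ here) (init w₁) (init w₂) agree-init ⟩
    evalR {n} c (init w₂)      ≡⟨ sym (evalR-free-last c cs w₂ last-free) ⟩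
    evalR {suc n} (c ∷ cs) w₂  ∎
    where
    k≤n : k ≤ n
    k≤n with ≰⇒> n≮k
    ... | s≤s k≤n = k≤n
    last-free : ¬ Any (λ d → ¬ IsZeroR {n} d) cs
    last-free x-occurs = n≮k (p∈Xk (suc n) (inj₁ (refl , x-occurs)))
    agree-init : take k (toList (init w₁)) ≡ take k (toList (init w₂))
    agree-init = begin
      take k (toList (init w₁))  ≡⟨ take-toList-init k k≤n w₁ ⟩
      take k (toList w₁)         ≡⟨ agree ⟩
      take k (toList w₂)         ≡⟨ sym (take-toList-init k k≤n w₂) ⟩
      take k (toList (init w₂))  ∎

  eval-extensions : ∀ {k n} {γ : Vec C k} {p : Poly n} {w₁ w₂ : Vec C n} → InVars k p →
                    Extends γ w₁ → Extends γ w₂ → eval p w₁ ≡ eval p w₂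
  eval-extensions {k} {γ = γ} {p} {w₁} {w₂} p∈Xk (r₁ , w₁≡) (r₂ , w₂≡) =
    evalR-local k (raw p) p∈Xk w₁ w₂ (begin
      take k (toList w₁)      ≡⟨ cong (take k) w₁≡ ⟩
      take k (toList γ ++ r₁) ≡⟨ take-toList-++ γ r₁ ⟩
      toList γ                ≡⟨ sym (take-toList-++ γ r₂) ⟩
      take k (toList γ ++ r₂) ≡⟨ cong (take k) (sym w₂≡) ⟩
      take k (toList w₂)      ∎)

  Sat⇒PSat : ∀ {k n} {γ : Vec C k} {ν : Vec C n} {g : Constraint n} →
             InVars k (cpoly g) → Extends γ ν → Sat ν g → PSat γ g
  Sat⇒PSat {γ = γ} {g = p , ≐0} p∈Xk ν⊒γ p[ν]≡0 w w⊒γ =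
    trans (eval-extensions {γ = γ} {p} p∈Xk w⊒γ ν⊒γ) p[ν]≡0
  Sat⇒PSat {γ = γ} {g = p , ≠0} p∈Xk ν⊒γ p[ν]≢0 w w⊒γ =
    p[ν]≢0 ∘ trans (eval-extensions {γ = γ} {p} p∈Xk ν⊒γ w⊒γ)

  ZeroSet-satisfied : ∀ {k n} {γ : Vec C k} {ν : Vec C n} (A : Clause n) →
                      (∀ a → A a → InVars k (cpoly a)) → (∀ a → A a → Sat ν a) →
                      Extends γ ν → ZeroSet (A⁼ A) (A≠ A) γ
  ZeroSet-satisfied {γ = γ} A A∈Xk ν⊨A ν⊒γ =
      (λ p p∈A → Sat⇒PSat {γ = γ} {g = p , ≐0} (A∈Xk _ p∈A) ν⊒γ (ν⊨A _ p∈A))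
    , (λ q q∈A → Sat⇒PSat {γ = γ} {g = q , ≠0} (A∈Xk _ q∈A) ν⊒γ (ν⊨A _ q∈A))

  Sat-¬neg : ∀ {n} (ν : Vec C n) (g : Constraint n) → ¬ Sat ν (neg g) → Sat ν g
  Sat-¬neg ν (p , ≐0) = decidable-stable (eval p ν ≟ 0#)
  Sat-¬neg ν (p , ≠0) ¬p[ν]≢0 = ¬p[ν]≢0

  neg-involutive : ∀ {n} (g : Constraint n) → neg (neg g) ≡ g
  neg-involutive (p , ≐0) = refl
  neg-involutive (p , ≠0) = refl

  InVars⇒¬Occurs : ∀ {n} m (u : Poly n) → InVars m u → ¬ Occurs (suc m) u
  InVars⇒¬Occurs m u u∈Xm = ¬sucm≤m ∘ u∈Xm (suc m)
    where
    ¬sucm≤m : ∀ {m} → ¬ suc m ≤ m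
    ¬sucm≤m {suc m} (s≤s p) = ¬sucm≤m p

  choice-PSat : ∀ {n m α} {ξ : Vec C m} {PQ} (c : Choice {n} m α PQ) → PairZero PQ ξ →
                PSat ξ (choiceConstraint c)
  choice-PSat (inP u _ u∈P _) (P≡0 , _) = P≡0 u u∈P
  choice-PSat (inQ u _ u∈Q _) (_ , Q≢0) = Q≢0 u u∈Q

  choice-false : ∀ {n m α PQ} (M : Trail n) (c : Choice {n} m α PQ) →
                 Value M m α (choiceConstraint c) false
  choice-false M (inP u u∈Xm _ u[α]≢0) = evalF (InVars⇒¬Occurs _ u u∈Xm) u[α]≢0
  choice-false M (inQ u u∈Xm _ u[α]≡0) =
    evalF (InVars⇒¬Occurs _ u u∈Xm) (λ w w⊒α u[w]≢0 → u[w]≢0 (u[α]≡0 w w⊒α))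

  Negations : ∀ {n} → Clause n → Clause n
  Negations A e = ∃[ a ] (A a × e ≡ neg a)

  Image : ∀ {n r} → (Fin r → Constraint n) → Clause n
  Image c e = ∃[ ℓ ] (e ≡ c ℓ)

  negations-∪-choices-valid :
    ∀ {n} m {α : Vec C m} → m < n → (A : Clause n) → (∀ a → A a → InVars (suc m) (cpoly a)) →
    (Δ : List (List (Poly n) × List (Poly n))) →
    (∀ ξ → InProj (A⁼ A) (A≠ A) ξ → Any (λ PQ → PairZero PQ ξ) Δ) →
    (ch : (ℓ : Fin (length Δ)) → Choice m α (lookup Δ ℓ)) →
    ValidLemma (Negations A ∪ Image (choiceConstraint ∘ ch))
  negations-∪-choices-valid m m<n A A∈Xk Δ covers ch ν E-false
    with toList-split m m<n ν
  ... | ξ , β , r , ν≡ =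
    E-false _ (inj₂ (ℓ , refl)) (choice-PSat (ch ℓ) (lookup-index ξ∈Δ) ν (β ∷ r , ν≡))
    where
    ν⊨A : ∀ a → A a → Sat ν a
    ν⊨A a a∈A = Sat-¬neg ν a (E-false (neg a) (inj₁ (a , a∈A , refl)))
    ξ∈Δ : Any (λ PQ → PairZero PQ ξ) Δ
    ξ∈Δ = covers ξ (β , ZeroSet-satisfied A A∈Xk ν⊨A (r , trans ν≡ (sym (toList-∷ʳ-++ ξ β r))))
    ℓ : Fin (length Δ)
    ℓ = index ξ∈Δ

  SetA-InVars : ∀ {n m α} {M : Trail n} {f : Constraint n} → IsLevel M m α →
                InVars (suc m) (cpoly f) → ∀ a → SetA M (suc m) f a → InVars (suc m) (cpoly a)
  SetA-InVars (_ , _ , M∈Xk) f∈Xk a (inj₁ (a∈M , _)) = M∈Xk a a∈M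
  SetA-InVars {f = p , r} _  f∈Xk a (inj₂ refl)      = f∈Xk

  negations-SetA-false : ∀ {n m α} (M : Trail n) (f f' : Constraint n) →
                         Negations (SetA M (suc m) f) f' → f' ≢ f → Value M m α f' false
  negations-SetA-false M f ._ ((p , r) , inj₁ (a∈M , x-occurs , _) , refl) _ =
    memF x-occurs (subst (λ g → InConstraints g M) (sym (neg-involutive (p , r))) a∈M)
  negations-SetA-false M f ._ (_ , inj₂ refl , refl) neg-neg-f≢f = ⊥-elim (neg-neg-f≢f (neg-involutive f))

-- The hypotheses f ∉ constraints(M) and ¬ f incompatible with M only serve to make a
-- decomposition Δ exist; the explanation property itself does not depend on them.
theorem1 : (F : FiniteField) → let open FF F in
    ∀ {n : ℕ} (m : ℕ) → m < n →
    (M : Trail n) (α : Vec (FiniteField.Carrier F) m) → IsLevel M m α →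
    (f : Constraint n) → InVars (suc m) (cpoly f) →
    ¬ InConstraints f M → ¬ Compatible M m α (neg f) →
    (Δ : List (List (Poly n) × List (Poly n))) →
    IsWPZD m α (A⁼ (SetA M (suc m) f)) (A≠ (SetA M (suc m) f)) Δ →
    (ch : (ℓ : Fin (length Δ)) → Choice m α (lookup Δ ℓ)) →
    ExplanationClause M m α
      (λ e → (∃[ a ] (SetA M (suc m) f a × e ≡ neg a))
             ⊎ (∃[ ℓ ] (e ≡ choiceConstraint (ch ℓ))))
      f
theorem1 F m m<n M α level f f∈Xk _ _ Δ (_ , _ , covers , _) ch =
    negations-∪-choices-valid m m<n A (SetA-InVars {α = α} level f∈Xk) Δ covers ch
  , inj₁ (neg f , inj₂ refl , sym (neg-involutive f))
  , justified
  where
  open FF F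
  open Explanation F
  A : Clause _
  A = SetA M (suc m) f
  justified : ∀ f' → (Negations A ∪ Image (choiceConstraint ∘ ch)) f' → f' ≢ f → Value M m α f' false
  justified f' (inj₁ f'∈¬A)     f'≢f = negations-SetA-false M f f' f'∈¬A f'≢f
  justified f' (inj₂ (ℓ , refl)) _   = choice-false M (ch ℓ)
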